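{- Let $L$ be a complete lattice. If $f \in \mathrm{Hom}_{\vee}(L,L)$ is a dualizing element of the quantale $(\mathrm{Hom}_{\vee}(L,L),\circ)$, then $f^{\wedge}$ and $f^{*}$ are inverse to each other and $L$ is completely distributive.
   Context: $\mathrm{Hom}_{\vee}(L,L)$ is the complete lattice of join-preserving maps $L\to L$, ordered pointwise, a quantale under composition. Divisions: $g\circ h \le k \iff h \le g\backslash k \iff g \le k/h$. An element $0$ of a quantale is dualizing if $0/(x\backslash 0) = (0/x)\backslash 0 = x$ for every $x$. For $f\in\mathrm{Hom}_{\vee}(L,L)$, $f^{\wedge}(x) := \bigwedge_{t\not\leq x} f(t)$ (a meet-preserving map) and $f^{*}$ is the left adjoint of $f^{\wedge}$. A complete lattice is completely distributive if $\bigwedge_{i\in I}\bigvee_{j\in J_i} z_{i,j} = \bigvee_{s}\bigwedge_{i\in I} z_{i,s(i)}$ for all families, $s$ ranging over choice functions with $s(i)\in J_i$. -}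

module Defs where

open import Level using (Level; suc; _⊔_)
open import Data.Product using (Σ; _×_; _,_; proj₁; proj₂)
open import Relation.Nullary using (¬_)
open import Relation.Binary.Bundles using (Poset)

record CompleteLattice (ℓ : Level) : Set (suc ℓ) where
  field
    poset : Poset ℓ ℓ ℓ
  open Poset poset public
  field
    ⨆ : {I : Set ℓ} → (I → Carrier) → Carrier
    ⨆-ub : {I : Set ℓ} (a : I → Carrier) (i : I) → a i ≤ ⨆ a
    ⨆-least : {I : Set ℓ} (a : I → Carrier) (u : Carrier) →
              (∀ i → a i ≤ u) → ⨆ a ≤ u
    ⨅ : {I : Set ℓ} → (I → Carrier) → Carrier
    ⨅-lb : {I : Set ℓ} (a : I → Carrier) (i : I) → ⨅ a ≤ a i
    ⨅-greatest : {I : Set ℓ} (a : I → Carrier) (l : Carrier) →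
                 (∀ i → l ≤ a i) → l ≤ ⨅ a

module _ {ℓ : Level} (L : CompleteLattice ℓ) where
  open CompleteLattice L

  -- A map of a complete lattice preserves all
  -- joins iff it has a right adjoint (r y = ⨆{x | f x ≤ y}); we record the
  -- map together with its right adjoint so that Hom stays a small type
  -- (needed to form the divisions as joins over Hom predicatively).
  record Hom : Set ℓ where
    field
      map    : Carrier → Carrier
      radj   : Carrier → Carrier
      galois : ∀ x y → (map x ≤ y → x ≤ radj y) × (x ≤ radj y → map x ≤ y)
  open Hom public

  _≤ₕ_ : Hom → Hom → Set ℓ
  g ≤ₕ h = ∀ x → map g x ≤ map h x

  _≈ₕ_ : Hom → Hom → Set ℓ
  g ≈ₕ h = ∀ x → map g x ≈ map h x

  _∘ₕ_ : Hom → Hom → Hom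
  map (g ∘ₕ h) x = map g (map h x)
  radj (g ∘ₕ h) y = radj h (radj g y)
  galois (g ∘ₕ h) x y =
    (λ p → proj₁ (galois h x (radj g y)) (proj₁ (galois g (map h x) y) p)) ,
    (λ p → proj₂ (galois g (map h x) y) (proj₂ (galois h x (radj g y)) p))

  ⨆ₕ : {I : Set ℓ} → (I → Hom) → Hom
  map (⨆ₕ hs) x = ⨆ (λ i → map (hs i) x)
  radj (⨆ₕ hs) y = ⨅ (λ i → radj (hs i) y)
  galois (⨆ₕ hs) x y =
    (λ p → ⨅-greatest _ x (λ i → proj₁ (galois (hs i) x y)
                 (trans (⨆-ub (λ j → map (hs j) x) i) p))) ,
    (λ p → ⨆-least _ y (λ i → proj₂ (galois (hs i) x y)
                 (trans p (⨅-lb (λ j → radj (hs j) y) i))))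

  _\\_ : Hom → Hom → Hom
  g \\ k = ⨆ₕ {I = Σ Hom (λ h → (g ∘ₕ h) ≤ₕ k)} proj₁

  _//_ : Hom → Hom → Hom
  k // h = ⨆ₕ {I = Σ Hom (λ g → (g ∘ₕ h) ≤ₕ k)} proj₁

  IsDualizing : Hom → Set ℓ
  IsDualizing d = ∀ x → ((d // (x \\ d)) ≈ₕ x) × (((d // x) \\ d) ≈ₕ x)

  wedge : Hom → Carrier → Carrier
  wedge f x = ⨅ {I = Σ Carrier (λ t → ¬ (t ≤ x))} (λ p → map f (proj₁ p))

  -- f^* : the left adjoint of f^∧, f^*(y) = ⋀{x | y ≤ f^∧(x)}
  star : Hom → Carrier → Carrier
  star f y = ⨅ {I = Σ Carrier (λ x → y ≤ wedge f x)} proj₁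

  CompletelyDistributive : Set (suc ℓ)
  CompletelyDistributive =
    (I : Set ℓ) (J : I → Set ℓ) (z : (i : I) → J i → Carrier) →
    ⨅ (λ i → ⨆ (λ j → z i j)) ≈ ⨆ {I = (i : I) → J i} (λ s → ⨅ (λ i → z i (s i)))

-- Write f^∧ = D.  Using the step maps e a b (t ↦ ⊥ if t ≤ a, else b) as test
-- elements of the quantale, the dualizing law x = f/(x\f) = (f/x)\f shows that
-- D reflects the order and is onto, so D is an order automorphism of L whose
-- inverse is its left adjoint f^*.  The same law applied to the join
-- G = ⋁_c e (f c) (D c) gives id ≤ G, i.e. every x lies below the join of the
-- D c with x ≰ f c, while D c ≤ t whenever t ≰ f c.  This is Raney's
-- approximation property, which yields complete distributivity.
module Submission where

open import Level using (Level)
open import Data.Product using (_×_; Σ; _,_; proj₁; proj₂)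
open import Data.Empty using (⊥-elim)
open import Data.Empty.Polymorphic using () renaming (⊥ to Empty)
open import Relation.Nullary using (¬_; Dec; yes; no)
open import Relation.Nullary.Decidable using (decidable-stable)
open import Axiom.ExcludedMiddle using (ExcludedMiddle)
open import Defs hiding (_≤ₕ_; _≈ₕ_; _∘ₕ_; _\\_; _//_)

module Basics {ℓ : Level} (L : CompleteLattice ℓ) where
  open CompleteLattice L

  ⊥ : Carrier
  ⊥ = ⨆ {I = Empty} λ ()

  ⊥-least : ∀ x → ⊥ ≤ x
  ⊥-least x = ⨆-least (λ ()) x λ ()

  ⊤ : Carrier
  ⊤ = ⨅ {I = Empty} λ ()

  ⊤-greatest : ∀ x → x ≤ ⊤
  ⊤-greatest x = ⨅-greatest (λ ()) x λ ()

  module _ (D : Carrier → Carrier) where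

    infPreimage : Carrier → Carrier
    infPreimage y = ⨅ {I = Σ Carrier λ x → y ≤ D x} proj₁

    infPreimage-leftInverse : (∀ {x y} → D x ≤ D y → x ≤ y) →
                              ∀ x → infPreimage (D x) ≈ x
    infPreimage-leftInverse reflect x =
      antisym (⨅-lb _ (x , refl)) (⨅-greatest _ _ λ (_ , Dx≤Dy) → reflect Dx≤Dy)

    infPreimage-rightInverse : (∀ {x y} → x ≤ y → D x ≤ D y) →
                               (∀ {x y} → D x ≤ D y → x ≤ y) →
                               (∀ y → Σ Carrier λ a → D a ≈ y) →
                               ∀ y → D (infPreimage y) ≈ y
    infPreimage-rightInverse mono reflect onto y = antisym
      (trans (mono (⨅-lb _ (a , reflexive (Eq.sym Da≈y)))) (reflexive Da≈y))
      (trans (reflexive (Eq.sym Da≈y))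
             (mono (⨅-greatest _ _ λ (_ , y≤Dx) → reflect (trans (reflexive Da≈y) y≤Dx))))
      where
        a = proj₁ (onto y)
        Da≈y = proj₂ (onto y)

  infix 4 _≤ₕ_ _≈ₕ_
  infixr 9 _∘ₕ_
  infixl 7 _\\_ _//_

  _≤ₕ_ : Hom L → Hom L → Set ℓ
  _≤ₕ_ = Defs._≤ₕ_ L

  _≈ₕ_ : Hom L → Hom L → Set ℓ
  _≈ₕ_ = Defs._≈ₕ_ L

  _∘ₕ_ : Hom L → Hom L → Hom L
  _∘ₕ_ = Defs._∘ₕ_ L

  _\\_ : Hom L → Hom L → Hom L
  _\\_ = Defs._\\_ L

  _//_ : Hom L → Hom L → Hom L
  _//_ = Defs._//_ L

  idₕ : Hom L
  map idₕ x = x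
  radj idₕ y = y
  galois idₕ x y = (λ x≤y → x≤y) , (λ x≤y → x≤y)

  map≤⇒≤radj : (h : Hom L) → ∀ {x y} → map h x ≤ y → x ≤ radj h y
  map≤⇒≤radj h = proj₁ (galois h _ _)

  ≤radj⇒map≤ : (h : Hom L) → ∀ {x y} → x ≤ radj h y → map h x ≤ y
  ≤radj⇒map≤ h = proj₂ (galois h _ _)

  map-mono : (h : Hom L) → ∀ {x y} → x ≤ y → map h x ≤ map h y
  map-mono h x≤y = ≤radj⇒map≤ h (trans x≤y (map≤⇒≤radj h refl))

  map-⊥ : (h : Hom L) → ∀ z → map h ⊥ ≤ z
  map-⊥ h z = ≤radj⇒map≤ h (⊥-least _)

  map-⨆ : (h : Hom L) {I : Set ℓ} (a : I → Carrier) → map h (⨆ a) ≤ ⨆ (λ i → map h (a i))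
  map-⨆ h a = ≤radj⇒map≤ h (⨆-least a _ λ i → map≤⇒≤radj h (⨆-ub (λ j → map h (a j)) i))

  \\-greatest : ∀ g h k → g ∘ₕ h ≤ₕ k → h ≤ₕ g \\ k
  \\-greatest g h k g∘h≤k x = ⨆-ub (λ (q : Σ (Hom L) λ h → g ∘ₕ h ≤ₕ k) → map (proj₁ q) x) (h , g∘h≤k)

  ∘\\-≤ : ∀ g k → g ∘ₕ (g \\ k) ≤ₕ k
  ∘\\-≤ g k x = trans (map-⨆ g _) (⨆-least _ _ λ (_ , g∘h≤k) → g∘h≤k x)

  //-greatest : ∀ g h k → g ∘ₕ h ≤ₕ k → g ≤ₕ k // h
  //-greatest g h k g∘h≤k x = ⨆-ub (λ (q : Σ (Hom L) λ g → g ∘ₕ h ≤ₕ k) → map (proj₁ q) x) (g , g∘h≤k)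

  //∘-≤ : ∀ k h → (k // h) ∘ₕ h ≤ₕ k
  //∘-≤ k h x = ⨆-least _ _ λ (_ , g∘h≤k) → g∘h≤k x

  //-antitone : ∀ k h h′ → h ≤ₕ h′ → k // h′ ≤ₕ k // h
  //-antitone k h h′ h≤h′ = //-greatest (k // h′) h k λ x →
    trans (map-mono (k // h′) (h≤h′ x)) (//∘-≤ k h′ x)

  module _ (f : Hom L) where

    wedge-greatest : ∀ {b x} → (∀ t → ¬ t ≤ x → b ≤ map f t) → b ≤ wedge L f x
    wedge-greatest b≤ft = ⨅-greatest _ _ λ (t , t≰x) → b≤ft t t≰x

    wedge-≤ : ∀ {t x} → ¬ t ≤ x → wedge L f x ≤ map f t
    wedge-≤ {t} t≰x = ⨅-lb _ (t , t≰x)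

    wedge-mono : ∀ {x y} → x ≤ y → wedge L f x ≤ wedge L f y
    wedge-mono x≤y = wedge-greatest λ t t≰y → wedge-≤ λ t≤x → t≰y (trans t≤x x≤y)

module Classical {ℓ : Level} (em : ExcludedMiddle ℓ) (L : CompleteLattice ℓ) where
  open CompleteLattice L
  open Basics L

  ⨆≰⇒∃≰ : {I : Set ℓ} (a : I → Carrier) {u : Carrier} → ¬ ⨆ a ≤ u → Σ I λ i → ¬ a i ≤ u
  ⨆≰⇒∃≰ a {u} ⨆a≰u = decidable-stable em λ none →
    ⨆a≰u (⨆-least a u λ i → decidable-stable em λ ai≰u → none (i , ai≰u))

  approximable⇒completelyDistributive :
    (D k : Carrier → Carrier) →
    (∀ c t → ¬ t ≤ k c → D c ≤ t) →
    (∀ x → x ≤ ⨆ {I = Σ Carrier λ c → ¬ x ≤ k c} (λ (c , _) → D c)) →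
    CompletelyDistributive L
  approximable⇒completelyDistributive D k D-below approx I J z =
    antisym meet≤join join≤meet
    where
      meet≤join : ⨅ (λ i → ⨆ (z i)) ≤ ⨆ (λ s → ⨅ (λ i → z i (s i)))
      meet≤join = trans (approx _) (⨆-least _ _ λ (c , meet≰kc) →
        let choice : ∀ i → Σ (J i) λ j → ¬ z i j ≤ k c
            choice i = ⨆≰⇒∃≰ (z i) λ ⨆zi≤kc → meet≰kc (trans (⨅-lb _ i) ⨆zi≤kc)
        in trans (⨅-greatest _ _ λ i → D-below c _ (proj₂ (choice i)))
                 (⨆-ub (λ s → ⨅ (λ i → z i (s i))) (λ i → proj₁ (choice i))))

      join≤meet : ⨆ (λ s → ⨅ (λ i → z i (s i))) ≤ ⨅ (λ i → ⨆ (z i))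
      join≤meet = ⨆-least _ _ λ s → ⨅-greatest _ _ λ i → trans (⨅-lb _ i) (⨆-ub (z i) (s i))

  stepAt : ∀ {t a} → Dec (t ≤ a) → Carrier → Carrier
  stepAt (yes _) b = ⊥
  stepAt (no _) b = b

  stepRadjAt : ∀ {b y} → Dec (b ≤ y) → Carrier → Carrier
  stepRadjAt (yes _) a = ⊤
  stepRadjAt (no _) a = a

  stepAt-galois : ∀ {t a b y} (t≤a? : Dec (t ≤ a)) (b≤y? : Dec (b ≤ y)) →
                  (stepAt t≤a? b ≤ y → t ≤ stepRadjAt b≤y? a) ×
                  (t ≤ stepRadjAt b≤y? a → stepAt t≤a? b ≤ y)
  stepAt-galois (yes t≤a) (yes _)   = (λ _ → ⊤-greatest _) , (λ _ → ⊥-least _)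
  stepAt-galois (yes t≤a) (no _)    = (λ _ → t≤a) , (λ _ → ⊥-least _)
  stepAt-galois (no _)    (yes b≤y) = (λ _ → ⊤-greatest _) , (λ _ → b≤y)
  stepAt-galois (no t≰a)  (no b≰y)  = (λ b≤y → ⊥-elim (b≰y b≤y)) , (λ t≤a → ⊥-elim (t≰a t≤a))

  step : Carrier → Carrier → Hom L
  map (step a b) t = stepAt (em {t ≤ a}) b
  radj (step a b) y = stepRadjAt (em {b ≤ y}) a
  galois (step a b) t y = stepAt-galois (em {t ≤ a}) (em {b ≤ y})

  step-below : ∀ {a b t} → t ≤ a → ∀ z → map (step a b) t ≤ z
  step-below {a} {t = t} t≤a z with em {t ≤ a}
  ... | yes _ = ⊥-least z
  ... | no t≰a = ⊥-elim (t≰a t≤a)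

  step-above : ∀ {a b t} → ¬ t ≤ a → b ≤ map (step a b) t
  step-above {a} {t = t} t≰a with em {t ≤ a}
  ... | yes t≤a = ⊥-elim (t≰a t≤a)
  ... | no _ = refl

  step-≤ : ∀ {a b t} → map (step a b) t ≤ b
  step-≤ {a} {t = t} with em {t ≤ a}
  ... | yes _ = ⊥-least _
  ... | no _ = refl

  map∘step-≤ : (g : Hom L) → ∀ {a b t z} → (¬ t ≤ a → map g b ≤ z) →
               map g (map (step a b) t) ≤ z
  map∘step-≤ g {a} {t = t} {z} gb≤z with em {t ≤ a}
  ... | yes _ = map-⊥ g z
  ... | no t≰a = gb≤z t≰a

  step⊤-≤⇒≥ : ∀ {a b} → step b ⊤ ≤ₕ step a ⊤ → a ≤ b
  step⊤-≤⇒≥ {a} {b} eb≤ea with em {a ≤ b}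
  ... | yes a≤b = a≤b
  ... | no a≰b = trans (⊤-greatest a) (trans (step-above a≰b) (trans (eb≤ea a) (step-below refl b)))

  step⊥-≤⇒≤ : ∀ {b c} → step ⊥ b ≤ₕ step ⊥ c → b ≤ c
  step⊥-≤⇒≤ {b} {c} eb≤ec with em {b ≤ ⊥}
  ... | yes b≤⊥ = trans b≤⊥ (⊥-least c)
  ... | no b≰⊥ = trans (step-above b≰⊥) (trans (eb≤ec b) step-≤)

module Dualizing {ℓ : Level} (em : ExcludedMiddle ℓ) (L : CompleteLattice ℓ)
                 (f : Hom L) (dual : IsDualizing L f) where
  open CompleteLattice L
  open Basics L
  open Classical em L

  //\\-inverse : ∀ x → f // (x \\ f) ≈ₕ x
  //\\-inverse x = proj₁ (dual x)

  \\//-inverse : ∀ x → (f // x) \\ f ≈ₕ x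
  \\//-inverse x = proj₂ (dual x)

  wedge-reflects : ∀ {a b} → wedge L f a ≤ wedge L f b → a ≤ b
  wedge-reflects {a} {b} Da≤Db = step⊤-≤⇒≥ λ t →
    trans (\\-greatest g (step b ⊤) f g∘eb≤f t) (reflexive (\\//-inverse (step a ⊤) t))
    where
      g = f // step a ⊤

      g⊤≤Da : map g ⊤ ≤ wedge L f a
      g⊤≤Da = wedge-greatest f λ t t≰a →
        trans (map-mono g (step-above t≰a)) (//∘-≤ f (step a ⊤) t)

      g∘eb≤f : g ∘ₕ step b ⊤ ≤ₕ f
      g∘eb≤f t = map∘step-≤ g λ t≰b → trans g⊤≤Da (trans Da≤Db (wedge-≤ f t≰b))

  -- The witness is the largest element killed by e ⊥ y \\ f.
  wedge-onto : ∀ y → Σ Carrier λ a → wedge L f a ≈ y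
  wedge-onto y = a , antisym (step⊥-≤⇒≤ eDa≤ey) y≤Da
    where
      k = step ⊥ y \\ f
      a = radj k ⊥

      y≤Da : y ≤ wedge L f a
      y≤Da = wedge-greatest f λ t t≰a →
        trans (step-above (λ kt≤⊥ → t≰a (map≤⇒≤radj k kt≤⊥)))
              (trans (reflexive (Eq.sym (//\\-inverse (step ⊥ y) (map k t)))) (//∘-≤ f k t))

      eDa∘k≤f : step ⊥ (wedge L f a) ∘ₕ k ≤ₕ f
      eDa∘k≤f t = map∘step-≤ idₕ λ kt≰⊥ → wedge-≤ f λ t≤a → kt≰⊥ (≤radj⇒map≤ k t≤a)

      eDa≤ey : step ⊥ (wedge L f a) ≤ₕ step ⊥ y
      eDa≤ey t = trans (//-greatest (step ⊥ (wedge L f a)) k f eDa∘k≤f t) (reflexive (//\\-inverse (step ⊥ y) t))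

  wedge-star : ∀ y → wedge L f (star L f y) ≈ y
  wedge-star = infPreimage-rightInverse (wedge L f) (wedge-mono f) wedge-reflects wedge-onto

  star-wedge : ∀ x → star L f (wedge L f x) ≈ x
  star-wedge = infPreimage-leftInverse (wedge L f) wedge-reflects

  id≤f//f : idₕ ≤ₕ f // f
  id≤f//f = //-greatest idₕ f f λ _ → refl

  f//f≤id : f // f ≤ₕ idₕ
  f//f≤id t = trans (//-antitone f (idₕ \\ f) f (∘\\-≤ idₕ f) t) (reflexive (//\\-inverse idₕ t))

  wedge-below : ∀ c t → ¬ t ≤ map f c → wedge L f c ≤ t
  wedge-below c t t≰fc = trans (step-above t≰fc) (ec≤id t)
    where
      ec∘f≤f : step (map f c) (wedge L f c) ∘ₕ f ≤ₕ f
      ec∘f≤f t′ = map∘step-≤ idₕ λ ft′≰fc → wedge-≤ f λ t′≤c → ft′≰fc (map-mono f t′≤c)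

      ec≤id : step (map f c) (wedge L f c) ≤ₕ idₕ
      ec≤id t′ = trans (//-greatest (step (map f c) (wedge L f c)) f f ec∘f≤f t′) (f//f≤id t′)

  G : Hom L
  G = ⨆ₕ L {I = Carrier} λ c → step (map f c) (wedge L f c)

  G\\f≤f : G \\ f ≤ₕ f
  G\\f≤f c = ≤radj⇒map≤ h (wedge-reflects (wedge-greatest f λ t t≰ →
    trans (step-above λ ht≤fc → t≰ (map≤⇒≤radj h ht≤fc))
          (trans (⨆-ub (λ c′ → map (step (map f c′) (wedge L f c′)) (map h t)) c) (∘\\-≤ G f t))))
    where h = G \\ f

  id≤G : idₕ ≤ₕ G
  id≤G x = trans (id≤f//f x) (trans (//-antitone f (G \\ f) f G\\f≤f x) (reflexive (//\\-inverse G x)))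

  wedge-approximates : ∀ x → x ≤ ⨆ {I = Σ Carrier λ c → ¬ x ≤ map f c} (λ (c , _) → wedge L f c)
  wedge-approximates x = trans (id≤G x) (⨆-least _ _ λ c →
    map∘step-≤ idₕ λ x≰fc → ⨆-ub (λ (c′ , _) → wedge L f c′) (c , x≰fc))

  completelyDistributive : CompletelyDistributive L
  completelyDistributive =
    approximable⇒completelyDistributive (wedge L f) (map f) wedge-below wedge-approximates

mainTheorem10 : {ℓ : Level} → ExcludedMiddle ℓ → (L : CompleteLattice ℓ) →
    (f : Hom L) → IsDualizing L f →
    ((∀ y → CompleteLattice._≈_ L (wedge L f (star L f y)) y)
      × (∀ x → CompleteLattice._≈_ L (star L f (wedge L f x)) x))
    × CompletelyDistributive L
mainTheorem10 em L f dual = (wedge-star , star-wedge) , completelyDistributive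
  where open Dualizing em L f dual
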